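{- Let $q\ge1$ be an integer, $\beta,J$ constants with $\mathrm{e}^{\beta J}\neq1$, and $\boldsymbol{B}=(B_1,\dots,B_q)\in\mathbb{C}^q$. Let $G$ be a finite graph with the magnetic field vector $\boldsymbol{B}$ at every vertex, and let $Z(G)=\sum_\sigma\mathrm{e}^{ -\beta h(\sigma)}$ with \[h(\sigma)=-J\sum_{\{v_i,v_j\}\in E(G)}\delta(\sigma_i,\sigma_j)-\sum_{v_i\in V(G)}\sum_{\alpha=1}^q B_\alpha\,\delta(\alpha,\sigma_i).\] Then \[Z(G)=(\mathrm{e}^{\beta J}-1)^{|V(G)|}\,U\big(G;\{x_k\}_{k\in\mathbb{Z}^+},\mathrm{e}^{\beta J}\big),\qquad x_k=\frac{1}{\mathrm{e}^{\beta J}-1}\sum_{\alpha=1}^q\mathrm{e}^{\beta kB_\alpha}.\]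
   Context: Graphs are finite, loops and multiple edges allowed. A state is a map $\sigma:V(G)\to\{1,\dots,q\}$, $\sigma_i=\sigma(v_i)$; $Z$ sums over all states; $\delta$ is the Kronecker delta. Noble and Welsh's $W$-polynomial $W(G,\omega;\boldsymbol{x},y)$ of a graph with vertex weights $\omega:V(G)\to\mathbb{Z}^+$ and variables $\boldsymbol{x}=\{x_k\}_{k\in\mathbb{Z}^+},y$ is defined recursively by: for a non-loop edge $e$, $W(G)=W(G-e)+W(G/e)$; for a loop $e$, $W(G)=yW(G-e)$; for $m$ isolated vertices of weights $\omega_1,\dots,\omega_m$, $W=\prod x_{\omega_i}$; here $G-e$ deletes $e$, weights unchanged, and $G/e$ contracts a non-loop edge, the merged vertex receiving the sum of the two endpoint weights. The $U$-polynomial of an unweighted graph $G$ is $U(G;\boldsymbol{x},y)=W(G,\omega;\boldsymbol{x},y)$ with $\omega(v)=1$ for all vertices $v$. -}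

module Defs where

open import Level using (Level; _⊔_) renaming (suc to lsuc)
open import Algebra.Bundles using (CommutativeRing)
open import Data.Nat using (ℕ; zero; suc)
import Data.Nat as ℕ
open import Data.Fin using (Fin; zero; suc; punchOut; punchIn; _≟_)
open import Data.Product using (_×_; _,_)
open import Data.Vec using (Vec; []; _∷_; lookup; map)
open import Relation.Nullary using (yes; no)
open import Relation.Binary.PropositionalEquality using (_≢_)

-- A finite multigraph (loops and multiple edges allowed) on vertex set Fin n
-- with m edges; each edge is an (unordered) pair of endpoints, a loop when
-- both endpoints coincide.
record Graph : Set where
  constructor graph
  field
    nV    : ℕ
    nE    : ℕ
    edges : Vec (Fin nV × Fin nV) nE

-- Contraction map: vertex v is merged into vertex u (u ≢ v); v is removed.
mergeMap : ∀ {n} {u v : Fin (suc n)} → u ≢ v → Fin (suc n) → Fin n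
mergeMap {u = u} {v} u≢v w with w ≟ v
... | yes _   = punchOut {i = v} {j = u} (λ eq → u≢v (Relation.Binary.PropositionalEquality.sym eq))
... | no w≢v  = punchOut {i = v} {j = w} (λ eq → w≢v (Relation.Binary.PropositionalEquality.sym eq))

mergeWeights : ∀ {n} (u v : Fin (suc n)) → (Fin (suc n) → ℕ) → Fin n → ℕ
mergeWeights u v ω j with punchIn v j ≟ u
... | yes _ = ω (punchIn v j) ℕ.+ ω v
... | no  _ = ω (punchIn v j)

module Poly {c ℓ : Level} (R : CommutativeRing c ℓ) where
  open CommutativeRing R using (Carrier; _+_; _*_; -_; 0#; 1#)

  prodFin : ∀ {n} → (Fin n → Carrier) → Carrier
  prodFin {zero}  f = 1#
  prodFin {suc n} f = f zero * prodFin (λ i → f (suc i))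

  sumFin : ∀ {n} → (Fin n → Carrier) → Carrier
  sumFin {zero}  f = 0#
  sumFin {suc n} f = f zero + sumFin (λ i → f (suc i))

  sumVec : ∀ {A : Set} {m} → (A → Carrier) → Vec A m → Carrier
  sumVec f []       = 0#
  sumVec f (a ∷ as) = f a + sumVec f as

  sumStates : ∀ {q n} → (Vec (Fin q) n → Carrier) → Carrier
  sumStates {q} {zero}  f = f []
  sumStates {q} {suc n} f = sumFin {q} (λ a → sumStates {q} {n} (λ τ → f (a ∷ τ)))

  pow : Carrier → ℕ → Carrier
  pow a zero    = 1#
  pow a (suc k) = a * pow a k

  fromℕ : ℕ → Carrier
  fromℕ zero    = 0#
  fromℕ (suc k) = 1# + fromℕ k

  δ : ∀ {q} → Fin q → Fin q → Carrier
  δ a b with a ≟ b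
  ... | yes _ = 1#
  ... | no  _ = 0#

  -- Noble–Welsh W-polynomial evaluated at x = (x_k)_k (only k ≥ 1 used),
  -- y ∈ R, computed by the deletion–contraction recursion on the first edge.
  W : (x : ℕ → Carrier) (y : Carrier) →
      ∀ {n m} → (Fin n → ℕ) → Vec (Fin n × Fin n) m → Carrier
  W x y {n}     {zero}  ω []               = prodFin (λ i → x (ω i))
  W x y {zero}  {suc m} ω ((() , _) ∷ es)
  W x y {suc n} {suc m} ω ((u , v) ∷ es) with u ≟ v
  ... | yes _   = y * W x y ω es
  ... | no u≢v  = W x y ω es
                + W x y (mergeWeights u v ω)
                    (map (λ { (a , b) → mergeMap u≢v a , mergeMap u≢v b }) es)

  U : Graph → (x : ℕ → Carrier) (y : Carrier) → Carrier
  U (graph n m es) x y = W x y {n} {m} (λ _ → 1) es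

  hamiltonian : ∀ {q} → (J : Carrier) (B : Fin q → Carrier) (G : Graph) →
                Vec (Fin q) (Graph.nV G) → Carrier
  hamiltonian {q} J B (graph n m es) σ =
      - (J * sumVec (λ { (i , j) → δ (lookup σ i) (lookup σ j) }) es)
    + - sumFin {n} (λ i → sumFin {q} (λ α → B α * δ α (lookup σ i)))

  Z : ∀ {q} → (exp : Carrier → Carrier) (β J : Carrier) (B : Fin q → Carrier)
      (G : Graph) → Carrier
  Z {q} exp β J B G = sumStates {q} {Graph.nV G} (λ σ → exp (- (β * hamiltonian J B G σ)))

module Submission where

-- Write y = e^{βJ} and d = y - 1.  Since δ ∈ {0,1}, the Boltzmann factor of
-- an edge is e^{βJ δ(σᵢ,σⱼ)} = 1 + d δ(σᵢ,σⱼ) (Fortuin–Kasteleyn), and the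
-- field factor of a vertex of colour α is e^{β B_α}.  We therefore study,
-- for arbitrary positive vertex weights ω, the weighted sum
--     Zω(G) = Σ_σ Π_{ij ∈ E} (1 + d δ(σᵢ,σⱼ)) · Π_i e^{β ω(i) B_{σᵢ}}
-- and prove Zω(G) = d^{|V|} W(G, ω; x, y) by induction along the
-- deletion–contraction recursion defining W:
--   * no edges: the sum factorises into Π_i Σ_α e^{β ω(i) B_α} = Π_i d x_{ω(i)};
--   * a loop contributes the constant factor 1 + d = y;
--   * a non-loop edge uv splits the sum as Z(G-e) + d Σ_σ δ(σ_u,σ_v)(…), and
--     the states with σ_u = σ_v are exactly the states of G/e, in which the
--     merged vertex carries the field factor of weight ω(u) + ω(v).

open import Defs
open import Level using (Level)
open import Algebra.Bundles using (CommutativeRing)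
open import Data.Nat using (ℕ; _≤_)
open import Data.Fin using (Fin)

import Data.Nat as ℕ
open import Data.Nat using (zero; suc)
open import Data.Fin using (zero; suc; punchIn; punchOut; _≟_)
open import Data.Fin.Properties
  using (punchIn-punchOut; punchIn-injective; punchInᵢ≢i; suc-injective)
open import Data.Vec using (Vec; []; _∷_; lookup; insertAt; map)
open import Data.Vec.Properties using (insertAt-lookup; insertAt-punchIn)
open import Data.Product using (_×_; _,_)
open import Data.Empty using (⊥-elim)
open import Relation.Nullary using (yes; no)
open import Relation.Binary.PropositionalEquality as ≡ using (_≡_; _≢_)
import Algebra.Properties.Ring as RingProperties
import Algebra.Properties.CommutativeSemigroup as CommutativeSemigroupProperties

module Contraction {n : ℕ} {u v : Fin (suc n)} (u≢v : u ≢ v) where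

  u′ : Fin n
  u′ = punchOut {i = v} {j = u} (λ v≡u → u≢v (≡.sym v≡u))

  punchIn-u′ : punchIn v u′ ≡ u
  punchIn-u′ = punchIn-punchOut _

  -- A colouring of G/e, read as a colouring of G in which v gets u's colour.
  expand : {A : Set} → Vec A n → Vec A (suc n)
  expand τ = insertAt τ v (lookup τ u′)

  lookup-expand : {A : Set} (τ : Vec A n) (w : Fin (suc n)) →
                  lookup (expand τ) w ≡ lookup τ (mergeMap u≢v w)
  lookup-expand τ w with w ≟ v
  ... | yes ≡.refl = insertAt-lookup τ v (lookup τ u′)
  ... | no _       = ≡.trans (≡.cong (lookup (expand τ)) (≡.sym (punchIn-punchOut _)))
                             (insertAt-punchIn τ v (lookup τ u′) _)

  contractEdge : Fin (suc n) × Fin (suc n) → Fin n × Fin n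
  contractEdge (a , b) = mergeMap u≢v a , mergeMap u≢v b

module Development {c ℓ : Level} (R : CommutativeRing c ℓ) where
  open CommutativeRing R hiding (zero)
  open Poly R
  open RingProperties ring using (-‿+-comm; -‿distribʳ-*; -‿involutive)
  open CommutativeSemigroupProperties *-commutativeSemigroup
    using (x∙yz≈y∙xz) renaming (interchange to *-interchange)
  open CommutativeSemigroupProperties +-commutativeSemigroup
    using () renaming (interchange to +-interchange)
  open import Relation.Binary.Reasoning.Setoid setoid

  sumFin-cong : ∀ {n} {f g : Fin n → Carrier} → (∀ i → f i ≈ g i) → sumFin f ≈ sumFin g
  sumFin-cong {zero}  f≈g = refl
  sumFin-cong {suc n} f≈g = +-cong (f≈g zero) (sumFin-cong (λ i → f≈g (suc i)))

  sumFin-zero : ∀ n → sumFin {n} (λ _ → 0#) ≈ 0#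
  sumFin-zero zero    = refl
  sumFin-zero (suc n) = trans (+-identityˡ _) (sumFin-zero n)

  sumFin-+ : ∀ {n} (f g : Fin n → Carrier) →
             sumFin (λ i → f i + g i) ≈ sumFin f + sumFin g
  sumFin-+ {zero}  f g = sym (+-identityˡ 0#)
  sumFin-+ {suc n} f g =
    trans (+-congˡ (sumFin-+ (λ i → f (suc i)) (λ i → g (suc i)))) (+-interchange _ _ _ _)

  *-distribˡ-sumFin : ∀ {n} a (f : Fin n → Carrier) →
                      a * sumFin f ≈ sumFin (λ i → a * f i)
  *-distribˡ-sumFin {zero}  a f = zeroʳ a
  *-distribˡ-sumFin {suc n} a f =
    trans (distribˡ a _ _) (+-congˡ (*-distribˡ-sumFin a (λ i → f (suc i))))

  sumFin-comm : ∀ {m n} (f : Fin m → Fin n → Carrier) →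
                sumFin (λ i → sumFin (f i)) ≈ sumFin (λ j → sumFin (λ i → f i j))
  sumFin-comm {zero}  {n} f = sym (sumFin-zero n)
  sumFin-comm {suc m} f =
    trans (+-congˡ (sumFin-comm (λ i → f (suc i))))
          (sym (sumFin-+ (f zero) (λ j → sumFin (λ i → f (suc i) j))))

  sumFin-single : ∀ {n} (c : Fin n) (f : Fin n → Carrier) →
                  (∀ a → a ≢ c → f a ≈ 0#) → sumFin f ≈ f c
  sumFin-single {suc n} zero f off = begin
    f zero + sumFin (λ a → f (suc a)) ≈⟨ +-congˡ (sumFin-cong (λ a → off (suc a) (λ ()))) ⟩
    f zero + sumFin {n} (λ _ → 0#)    ≈⟨ +-congˡ (sumFin-zero n) ⟩
    f zero + 0#                       ≈⟨ +-identityʳ _ ⟩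
    f zero                            ∎
  sumFin-single {suc n} (suc c) f off = begin
    f zero + sumFin (λ a → f (suc a)) ≈⟨ +-cong (off zero (λ ())) (sumFin-single c _ off′) ⟩
    0# + f (suc c)                    ≈⟨ +-identityˡ _ ⟩
    f (suc c)                         ∎
    where
    off′ : ∀ a → a ≢ c → f (suc a) ≈ 0#
    off′ a a≢c = off (suc a) (λ sa≡sc → a≢c (suc-injective sa≡sc))

  prodFin-cong : ∀ {n} {f g : Fin n → Carrier} → (∀ i → f i ≈ g i) → prodFin f ≈ prodFin g
  prodFin-cong {zero}  f≈g = refl
  prodFin-cong {suc n} f≈g = *-cong (f≈g zero) (prodFin-cong (λ i → f≈g (suc i)))

  prodFin-* : ∀ {n} (f g : Fin n → Carrier) →
              prodFin (λ i → f i * g i) ≈ prodFin f * prodFin g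
  prodFin-* {zero}  f g = sym (*-identityˡ 1#)
  prodFin-* {suc n} f g =
    trans (*-congˡ (prodFin-* (λ i → f (suc i)) (λ i → g (suc i)))) (*-interchange _ _ _ _)

  prodFin-const : ∀ n a → prodFin {n} (λ _ → a) ≡ pow a n
  prodFin-const zero    a = ≡.refl
  prodFin-const (suc n) a = ≡.cong (a *_) (prodFin-const n a)

  prodFin-remove : ∀ {n} (v : Fin (suc n)) (f : Fin (suc n) → Carrier) →
                   prodFin f ≈ f v * prodFin (λ j → f (punchIn v j))
  prodFin-remove zero            f = refl
  prodFin-remove {suc n} (suc v) f =
    trans (*-congˡ (prodFin-remove v (λ j → f (suc j)))) (x∙yz≈y∙xz _ _ _)

  mergeFactors : ∀ {n} (u v : Fin (suc n)) → (Fin (suc n) → Carrier) → Fin n → Carrier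
  mergeFactors u v f j with punchIn v j ≟ u
  ... | yes _ = f (punchIn v j) * f v
  ... | no  _ = f (punchIn v j)

  prodFin-merge : ∀ {n} {u v : Fin (suc n)} (w : Fin n) → punchIn v w ≡ u →
                  (f : Fin (suc n) → Carrier) → prodFin f ≈ prodFin (mergeFactors u v f)
  prodFin-merge {suc n} {v = v} w ≡.refl f = begin
    prodFin f                                       ≈⟨ prodFin-remove v f ⟩
    f v * prodFin (λ j → f (punchIn v j))           ≈⟨ *-congˡ (prodFin-remove w (λ j → f (punchIn v j))) ⟩
    f v * (f (punchIn v w) * rest)                  ≈⟨ x∙yz≈y∙xz _ _ _ ⟩
    f (punchIn v w) * (f v * rest)                  ≈⟨ sym (*-assoc _ _ _) ⟩
    (f (punchIn v w) * f v) * rest                  ≈⟨ *-cong (reflexive merged) (prodFin-cong (λ k → reflexive (kept k))) ⟩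
    merge w * prodFin (λ k → merge (punchIn w k))   ≈⟨ sym (prodFin-remove w merge) ⟩
    prodFin merge                                   ∎
    where
    merge : Fin (suc n) → Carrier
    merge = mergeFactors (punchIn v w) v f
    rest : Carrier
    rest = prodFin (λ k → f (punchIn v (punchIn w k)))
    merged : f (punchIn v w) * f v ≡ merge w
    merged with punchIn v w ≟ punchIn v w
    ... | yes _ = ≡.refl
    ... | no ne = ⊥-elim (ne ≡.refl)
    kept : ∀ k → f (punchIn v (punchIn w k)) ≡ merge (punchIn w k)
    kept k with punchIn v (punchIn w k) ≟ punchIn v w
    ... | yes e = ⊥-elim (punchInᵢ≢i w k (punchIn-injective v _ _ e))
    ... | no  _ = ≡.refl

  prodVec : ∀ {A : Set} {m} → (A → Carrier) → Vec A m → Carrier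
  prodVec f []       = 1#
  prodVec f (a ∷ as) = f a * prodVec f as

  prodVec-cong : ∀ {A : Set} {m} {f g : A → Carrier} → (∀ a → f a ≈ g a) →
                 (as : Vec A m) → prodVec f as ≈ prodVec g as
  prodVec-cong f≈g []       = refl
  prodVec-cong f≈g (a ∷ as) = *-cong (f≈g a) (prodVec-cong f≈g as)

  prodVec-map : ∀ {A B : Set} {m} (f : B → Carrier) (h : A → B) (as : Vec A m) →
                prodVec f (map h as) ≡ prodVec (λ a → f (h a)) as
  prodVec-map f h []       = ≡.refl
  prodVec-map f h (a ∷ as) = ≡.cong (f (h a) *_) (prodVec-map f h as)

  *-distribˡ-sumVec : ∀ {A : Set} {m} a (f : A → Carrier) (as : Vec A m) →
                      a * sumVec f as ≈ sumVec (λ e → a * f e) as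
  *-distribˡ-sumVec a f []       = zeroʳ a
  *-distribˡ-sumVec a f (e ∷ as) = trans (distribˡ a _ _) (+-congˡ (*-distribˡ-sumVec a f as))

  sumStates-cong : ∀ {q n} {f g : Vec (Fin q) n → Carrier} → (∀ σ → f σ ≈ g σ) →
                   sumStates f ≈ sumStates g
  sumStates-cong {n = zero}  f≈g = f≈g []
  sumStates-cong {n = suc n} f≈g = sumFin-cong (λ a → sumStates-cong (λ τ → f≈g (a ∷ τ)))

  sumStates-+ : ∀ {q n} (f g : Vec (Fin q) n → Carrier) →
                sumStates (λ σ → f σ + g σ) ≈ sumStates f + sumStates g
  sumStates-+ {n = zero}  f g = refl
  sumStates-+ {n = suc n} f g =
    trans (sumFin-cong (λ a → sumStates-+ (λ τ → f (a ∷ τ)) (λ τ → g (a ∷ τ))))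
          (sumFin-+ (λ a → sumStates (λ τ → f (a ∷ τ))) (λ a → sumStates (λ τ → g (a ∷ τ))))

  *-distribˡ-sumStates : ∀ {q n} a (f : Vec (Fin q) n → Carrier) →
                         a * sumStates f ≈ sumStates (λ σ → a * f σ)
  *-distribˡ-sumStates {n = zero}  a f = refl
  *-distribˡ-sumStates {n = suc n} a f =
    trans (*-distribˡ-sumFin a (λ b → sumStates (λ τ → f (b ∷ τ))))
          (sumFin-cong (λ b → *-distribˡ-sumStates a (λ τ → f (b ∷ τ))))

  sumStates-sumFin : ∀ {q n k} (f : Fin k → Vec (Fin q) n → Carrier) →
                     sumStates (λ τ → sumFin (λ a → f a τ)) ≈ sumFin (λ a → sumStates (f a))
  sumStates-sumFin {n = zero}  f = refl
  sumStates-sumFin {n = suc n} f =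
    trans (sumFin-cong (λ b → sumStates-sumFin (λ a τ → f a (b ∷ τ))))
          (sumFin-comm (λ b a → sumStates (λ τ → f a (b ∷ τ))))

  sumStates-insertAt : ∀ {q n} (v : Fin (suc n)) (f : Vec (Fin q) (suc n) → Carrier) →
                       sumStates f ≈ sumFin (λ a → sumStates (λ τ → f (insertAt τ v a)))
  sumStates-insertAt zero            f = refl
  sumStates-insertAt {n = suc n} (suc v) f =
    trans (sumFin-cong (λ b → sumStates-insertAt v (λ σ → f (b ∷ σ))))
          (sumFin-comm (λ b a → sumStates (λ τ → f (b ∷ insertAt τ v a))))

  sumStates-prodFin : ∀ {q n} (f : Fin n → Fin q → Carrier) →
                      sumStates (λ σ → prodFin (λ i → f i (lookup σ i)))
                        ≈ prodFin (λ i → sumFin (f i))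
  sumStates-prodFin {n = zero}  f = refl
  sumStates-prodFin {q} {suc n} f = begin
    sumFin (λ a → sumStates (λ τ → f zero a * rest τ))
      ≈⟨ sumFin-cong (λ a → sym (*-distribˡ-sumStates (f zero a) rest)) ⟩
    sumFin (λ a → f zero a * sumStates rest)
      ≈⟨ sumFin-cong (λ a → *-comm (f zero a) _) ⟩
    sumFin (λ a → sumStates rest * f zero a)
      ≈⟨ sym (*-distribˡ-sumFin (sumStates rest) (f zero)) ⟩
    sumStates rest * sumFin (f zero)
      ≈⟨ *-comm _ _ ⟩
    sumFin (f zero) * sumStates rest
      ≈⟨ *-congˡ (sumStates-prodFin (λ i → f (suc i))) ⟩
    sumFin (f zero) * prodFin (λ i → sumFin (f (suc i)))  ∎
    where
    rest : Vec (Fin q) n → Carrier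
    rest τ = prodFin (λ i → f (suc i) (lookup τ i))

  δ-refl : ∀ {q} (a : Fin q) → δ a a ≈ 1#
  δ-refl a with a ≟ a
  ... | yes _ = refl
  ... | no ne = ⊥-elim (ne ≡.refl)

  δ-≢ : ∀ {q} {a b : Fin q} → a ≢ b → δ a b ≈ 0#
  δ-≢ {a = a} {b} a≢b with a ≟ b
  ... | yes a≡b = ⊥-elim (a≢b a≡b)
  ... | no  _   = refl

  sift : ∀ {q} (c : Fin q) (K : Fin q → Carrier) → sumFin (λ a → δ c a * K a) ≈ K c
  sift c K = trans (sumFin-single c _ (λ a a≢c → trans (*-congʳ (δ-≢ (λ c≡a → a≢c (≡.sym c≡a)))) (zeroˡ _)))
                   (trans (*-congʳ (δ-refl c)) (*-identityˡ _))

  siftʳ : ∀ {q} (c : Fin q) (K : Fin q → Carrier) → sumFin (λ a → K a * δ a c) ≈ K c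
  siftʳ c K = trans (sumFin-single c _ (λ a a≢c → trans (*-congˡ (δ-≢ a≢c)) (zeroʳ _)))
                    (trans (*-congˡ (δ-refl c)) (*-identityʳ _))

  sumStates-diagonal : ∀ {q n} {u v : Fin (suc n)} (u≢v : u ≢ v)
                       (H : Vec (Fin q) (suc n) → Carrier) →
                       sumStates (λ σ → δ (lookup σ u) (lookup σ v) * H σ)
                         ≈ sumStates (λ τ → H (Contraction.expand u≢v τ))
  sumStates-diagonal {q} {n} {u} {v} u≢v H = begin
    sumStates (λ σ → δ (lookup σ u) (lookup σ v) * H σ)
      ≈⟨ sumStates-insertAt v (λ σ → δ (lookup σ u) (lookup σ v) * H σ) ⟩
    sumFin (λ a → sumStates (λ τ → δ (lookup (insertAt τ v a) u) (lookup (insertAt τ v a) v)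
                                     * H (insertAt τ v a)))
      ≈⟨ sumFin-cong (λ a → sumStates-cong (λ τ → *-congʳ (reflexive (colours τ a)))) ⟩
    sumFin (λ a → sumStates (λ τ → δ (lookup τ u′) a * H (insertAt τ v a)))
      ≈⟨ sym (sumStates-sumFin (λ a τ → δ (lookup τ u′) a * H (insertAt τ v a))) ⟩
    sumStates (λ τ → sumFin (λ a → δ (lookup τ u′) a * H (insertAt τ v a)))
      ≈⟨ sumStates-cong (λ τ → sift (lookup τ u′) (λ a → H (insertAt τ v a))) ⟩
    sumStates (λ τ → H (expand τ))  ∎
    where
    open Contraction u≢v using (u′; punchIn-u′; expand)
    colours : ∀ (τ : Vec (Fin q) n) a → δ (lookup (insertAt τ v a) u) (lookup (insertAt τ v a) v)
                        ≡ δ (lookup τ u′) a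
    colours τ a = ≡.cong₂ δ
      (≡.trans (≡.cong (lookup (insertAt τ v a)) (≡.sym punchIn-u′)) (insertAt-punchIn τ v a u′))
      (insertAt-lookup τ v a)

  fromℕ-+ : ∀ a b → fromℕ (a ℕ.+ b) ≈ fromℕ a + fromℕ b
  fromℕ-+ zero    b = sym (+-identityˡ _)
  fromℕ-+ (suc a) b = trans (+-congˡ (fromℕ-+ a b)) (sym (+-assoc _ _ _))

  negate-scaled-negatives : ∀ b s t → - (b * (- s + - t)) ≈ b * s + b * t
  negate-scaled-negatives b s t = begin
    - (b * (- s + - t)) ≈⟨ -‿cong (*-congˡ (-‿+-comm s t)) ⟩
    - (b * - (s + t))   ≈⟨ -‿cong (sym (-‿distribʳ-* b (s + t))) ⟩
    - (- (b * (s + t))) ≈⟨ -‿involutive _ ⟩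
    b * (s + t)         ≈⟨ distribˡ b s t ⟩
    b * s + b * t       ∎

  module Exponential (exp : Carrier → Carrier)
                     (exp-cong : ∀ {a b} → a ≈ b → exp a ≈ exp b)
                     (exp-+ : ∀ a b → exp (a + b) ≈ exp a * exp b)
                     (exp-0 : exp 0# ≈ 1#)
                     where

    exp-sumFin : ∀ {n} (f : Fin n → Carrier) → exp (sumFin f) ≈ prodFin (λ i → exp (f i))
    exp-sumFin {zero}  f = exp-0
    exp-sumFin {suc n} f = trans (exp-+ _ _) (*-congˡ (exp-sumFin (λ i → f (suc i))))

    exp-sumVec : ∀ {A : Set} {m} (f : A → Carrier) (as : Vec A m) →
                 exp (sumVec f as) ≈ prodVec (λ a → exp (f a)) as
    exp-sumVec f []       = exp-0
    exp-sumVec f (a ∷ as) = trans (exp-+ _ _) (*-congˡ (exp-sumVec f as))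

    module Potts (q : ℕ) (β J : Carrier) (B : Fin q → Carrier)
                 (inv : Carrier) (inv-inverse : inv * (exp (β * J) + - 1#) ≈ 1#)
                 where

      y d : Carrier
      y = exp (β * J)
      d = y + - 1#

      siteWeight : ℕ → Fin q → Carrier
      siteWeight k α = exp (β * (fromℕ k * B α))

      x : ℕ → Carrier
      x k = inv * sumFin (siteWeight k)

      agree : ∀ {n} → Vec (Fin q) n → Fin n × Fin n → Carrier
      agree σ (i , j) = δ (lookup σ i) (lookup σ j)

      bond : ∀ {n} → Vec (Fin q) n → Fin n × Fin n → Carrier
      bond σ e = 1# + d * agree σ e

      sites : ∀ {n} → (Fin n → ℕ) → Vec (Fin q) n → Carrier
      sites ω σ = prodFin (λ i → siteWeight (ω i) (lookup σ i))

      weight : ∀ {n m} → (Fin n → ℕ) → Vec (Fin n × Fin n) m → Vec (Fin q) n → Carrier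
      weight ω es σ = prodVec (bond σ) es * sites ω σ

      Zω : ∀ {n m} → (Fin n → ℕ) → Vec (Fin n × Fin n) m → Carrier
      Zω ω es = sumStates (weight ω es)

      d*x : ∀ k → d * x k ≈ sumFin (siteWeight k)
      d*x k = begin
        d * (inv * sumFin (siteWeight k)) ≈⟨ sym (*-assoc _ _ _) ⟩
        (d * inv) * sumFin (siteWeight k) ≈⟨ *-congʳ (trans (*-comm d inv) inv-inverse) ⟩
        1# * sumFin (siteWeight k)        ≈⟨ *-identityˡ _ ⟩
        sumFin (siteWeight k)             ∎

      siteWeight-+ : ∀ a b α → siteWeight (a ℕ.+ b) α ≈ siteWeight a α * siteWeight b α
      siteWeight-+ a b α = trans (exp-cong exponent) (exp-+ _ _)
        where
        exponent : β * (fromℕ (a ℕ.+ b) * B α) ≈ β * (fromℕ a * B α) + β * (fromℕ b * B α)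
        exponent = trans (*-congˡ (trans (*-congʳ (fromℕ-+ a b)) (distribʳ _ _ _))) (distribˡ _ _ _)

      1+d≈y : 1# + d ≈ y
      1+d≈y = begin
        1# + (y + - 1#) ≈⟨ +-comm _ _ ⟩
        (y + - 1#) + 1# ≈⟨ +-assoc _ _ _ ⟩
        y + (- 1# + 1#) ≈⟨ +-congˡ (-‿inverseˡ 1#) ⟩
        y + 0#          ≈⟨ +-identityʳ y ⟩
        y               ∎

      exp-coupling : ∀ (a b : Fin q) → exp (β * (J * δ a b)) ≈ 1# + d * δ a b
      exp-coupling a b with a ≟ b
      ... | yes _ = trans (exp-cong (*-congˡ (*-identityʳ J)))
                          (sym (trans (+-congˡ (*-identityʳ d)) 1+d≈y))
      ... | no  _ = trans (exp-cong (trans (*-congˡ (zeroʳ J)) (zeroʳ β)))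
                          (trans exp-0 (sym (trans (+-congˡ (zeroʳ d)) (+-identityʳ 1#))))

      bond-loop : ∀ {n} (σ : Vec (Fin q) n) i → bond σ (i , i) ≈ y
      bond-loop σ i = trans (+-congˡ (trans (*-congˡ (δ-refl (lookup σ i))) (*-identityʳ d))) 1+d≈y

      Zω-edgeless : ∀ {n} (ω : Fin n → ℕ) → Zω ω [] ≈ pow d n * prodFin (λ i → x (ω i))
      Zω-edgeless {n} ω = begin
        sumStates (λ σ → 1# * sites ω σ)          ≈⟨ sumStates-cong (λ σ → *-identityˡ (sites ω σ)) ⟩
        sumStates (sites ω)                       ≈⟨ sumStates-prodFin (λ i → siteWeight (ω i)) ⟩
        prodFin (λ i → sumFin (siteWeight (ω i))) ≈⟨ prodFin-cong (λ i → sym (d*x (ω i))) ⟩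
        prodFin (λ i → d * x (ω i))               ≈⟨ prodFin-* (λ _ → d) (λ i → x (ω i)) ⟩
        prodFin {n} (λ _ → d) * prodFin (λ i → x (ω i))
          ≡⟨ ≡.cong (_* prodFin (λ i → x (ω i))) (prodFin-const n d) ⟩
        pow d n * prodFin (λ i → x (ω i))         ∎

      Zω-loop : ∀ {n m} (ω : Fin n → ℕ) (u : Fin n) (es : Vec (Fin n × Fin n) m) →
                Zω ω ((u , u) ∷ es) ≈ y * Zω ω es
      Zω-loop ω u es = begin
        sumStates (λ σ → (bond σ (u , u) * prodVec (bond σ) es) * sites ω σ)
          ≈⟨ sumStates-cong (λ σ → trans (*-assoc _ _ _) (*-congʳ (bond-loop σ u))) ⟩
        sumStates (λ σ → y * weight ω es σ)
          ≈⟨ sym (*-distribˡ-sumStates y (weight ω es)) ⟩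
        y * Zω ω es ∎

      module _ {n : ℕ} {u v : Fin (suc n)} (u≢v : u ≢ v) where
        open Contraction u≢v

        bonds-expand : ∀ {m} (es : Vec (Fin (suc n) × Fin (suc n)) m) (τ : Vec (Fin q) n) →
                       prodVec (bond (expand τ)) es ≈ prodVec (bond τ) (map contractEdge es)
        bonds-expand es τ = begin
          prodVec (bond (expand τ)) es                ≈⟨ prodVec-cong relabel es ⟩
          prodVec (λ e → bond τ (contractEdge e)) es  ≡⟨ prodVec-map (bond τ) contractEdge es ⟨
          prodVec (bond τ) (map contractEdge es)      ∎
          where
          relabel : ∀ e → bond (expand τ) e ≈ bond τ (contractEdge e)
          relabel (a , b) = reflexive (≡.cong₂ (λ s t → 1# + d * δ s t) (lookup-expand τ a) (lookup-expand τ b))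

        -- In an expanded colouring u and v share a colour, so their field
        -- factors combine into that of a vertex of weight ω u + ω v.
        sites-expand : (ω : Fin (suc n) → ℕ) (τ : Vec (Fin q) n) →
                       sites ω (expand τ) ≈ sites (mergeWeights u v ω) τ
        sites-expand ω τ = trans (prodFin-merge u′ punchIn-u′ f) (prodFin-cong merged)
          where
          f : Fin (suc n) → Carrier
          f i = siteWeight (ω i) (lookup (expand τ) i)
          merged : ∀ j → mergeFactors u v f j ≈ siteWeight (mergeWeights u v ω j) (lookup τ j)
          merged j with punchIn v j ≟ u
          ... | yes e = begin
            siteWeight (ω (punchIn v j)) (lookup (expand τ) (punchIn v j))
              * siteWeight (ω v) (lookup (expand τ) v)
              ≡⟨ ≡.cong₂ (λ s t → siteWeight (ω (punchIn v j)) s * siteWeight (ω v) t)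
                         (insertAt-punchIn τ v (lookup τ u′) j)
                         (≡.trans (insertAt-lookup τ v (lookup τ u′)) (≡.cong (lookup τ) u′≡j)) ⟩
            siteWeight (ω (punchIn v j)) (lookup τ j) * siteWeight (ω v) (lookup τ j)
              ≈⟨ sym (siteWeight-+ (ω (punchIn v j)) (ω v) (lookup τ j)) ⟩
            siteWeight (ω (punchIn v j) ℕ.+ ω v) (lookup τ j) ∎
            where
            u′≡j : u′ ≡ j
            u′≡j = punchIn-injective v u′ j (≡.trans punchIn-u′ (≡.sym e))
          ... | no _ = reflexive (≡.cong (siteWeight (ω (punchIn v j))) (insertAt-punchIn τ v (lookup τ u′) j))

        weight-expand : ∀ {m} (ω : Fin (suc n) → ℕ) (es : Vec (Fin (suc n) × Fin (suc n)) m)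
                        (τ : Vec (Fin q) n) →
                        weight ω es (expand τ) ≈ weight (mergeWeights u v ω) (map contractEdge es) τ
        weight-expand ω es τ = *-cong (bonds-expand es τ) (sites-expand ω τ)

        -- Deletion–contraction: the bond 1 + d δ of e splits the sum into
        -- the sum for G - e and d times the sum over colourings with σ_u = σ_v.
        Zω-deletion-contraction : ∀ {m} (ω : Fin (suc n) → ℕ) (es : Vec (Fin (suc n) × Fin (suc n)) m) →
          Zω ω ((u , v) ∷ es) ≈ Zω ω es + d * Zω (mergeWeights u v ω) (map contractEdge es)
        Zω-deletion-contraction ω es = begin
          sumStates (λ σ → (bond σ (u , v) * prodVec (bond σ) es) * sites ω σ)
            ≈⟨ sumStates-cong split ⟩
          sumStates (λ σ → weight ω es σ + d * (agree σ (u , v) * weight ω es σ))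
            ≈⟨ sumStates-+ (weight ω es) (λ σ → d * (agree σ (u , v) * weight ω es σ)) ⟩
          Zω ω es + sumStates (λ σ → d * (agree σ (u , v) * weight ω es σ))
            ≈⟨ +-congˡ (sym (*-distribˡ-sumStates d (λ σ → agree σ (u , v) * weight ω es σ))) ⟩
          Zω ω es + d * sumStates (λ σ → agree σ (u , v) * weight ω es σ)
            ≈⟨ +-congˡ (*-congˡ (sumStates-diagonal u≢v (weight ω es))) ⟩
          Zω ω es + d * sumStates (λ τ → weight ω es (expand τ))
            ≈⟨ +-congˡ (*-congˡ (sumStates-cong (weight-expand ω es))) ⟩
          Zω ω es + d * Zω (mergeWeights u v ω) (map contractEdge es) ∎
          where
          split : ∀ σ → (bond σ (u , v) * prodVec (bond σ) es) * sites ω σ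
                          ≈ weight ω es σ + d * (agree σ (u , v) * weight ω es σ)
          split σ = begin
            (bond σ (u , v) * prodVec (bond σ) es) * sites ω σ  ≈⟨ *-assoc _ _ _ ⟩
            (1# + d * agree σ (u , v)) * weight ω es σ          ≈⟨ distribʳ _ _ _ ⟩
            1# * weight ω es σ + (d * agree σ (u , v)) * weight ω es σ
              ≈⟨ +-cong (*-identityˡ _) (*-assoc _ _ _) ⟩
            weight ω es σ + d * (agree σ (u , v) * weight ω es σ) ∎

      Zω≈W : ∀ {n m} (ω : Fin n → ℕ) (es : Vec (Fin n × Fin n) m) → Zω ω es ≈ pow d n * W x y ω es
      Zω≈W ω [] = Zω-edgeless ω
      Zω≈W {zero} ω ((() , _) ∷ es)
      Zω≈W {suc n} {suc m} ω ((u , v) ∷ es) with u ≟ v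
      ... | yes ≡.refl = begin
        Zω ω ((u , u) ∷ es)          ≈⟨ Zω-loop ω u es ⟩
        y * Zω ω es                  ≈⟨ *-congˡ (Zω≈W ω es) ⟩
        y * (pow d (suc n) * W x y ω es) ≈⟨ x∙yz≈y∙xz _ _ _ ⟩
        pow d (suc n) * (y * W x y ω es) ∎
      ... | no u≢v = begin
        Zω ω ((u , v) ∷ es)
          ≈⟨ Zω-deletion-contraction u≢v ω es ⟩
        Zω ω es + d * Zω ω′ es′
          ≈⟨ +-cong (Zω≈W ω es) (*-congˡ (Zω≈W ω′ es′)) ⟩
        pow d (suc n) * W x y ω es + d * (pow d n * W x y ω′ es′)
          ≈⟨ +-congˡ (sym (*-assoc _ _ _)) ⟩
        pow d (suc n) * W x y ω es + pow d (suc n) * W x y ω′ es′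
          ≈⟨ sym (distribˡ _ _ _) ⟩
        pow d (suc n) * (W x y ω es + W x y ω′ es′) ∎
        where
        ω′ : Fin n → ℕ
        ω′ = mergeWeights u v ω
        es′ : Vec (Fin n × Fin n) m
        es′ = map (Contraction.contractEdge u≢v) es

      exp-coupling-energy : ∀ {n m} (σ : Vec (Fin q) n) (es : Vec (Fin n × Fin n) m) →
                            exp (β * (J * sumVec (agree σ) es)) ≈ prodVec (bond σ) es
      exp-coupling-energy σ es = begin
        exp (β * (J * sumVec (agree σ) es))
          ≈⟨ exp-cong (trans (*-congˡ (*-distribˡ-sumVec J (agree σ) es))
                             (*-distribˡ-sumVec β (λ e → J * agree σ e) es)) ⟩
        exp (sumVec (λ e → β * (J * agree σ e)) es)
          ≈⟨ exp-sumVec (λ e → β * (J * agree σ e)) es ⟩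
        prodVec (λ e → exp (β * (J * agree σ e))) es
          ≈⟨ prodVec-cong (λ { (i , j) → exp-coupling (lookup σ i) (lookup σ j) }) es ⟩
        prodVec (bond σ) es ∎

      exp-field-energy : ∀ {n} (σ : Vec (Fin q) n) →
                         exp (β * sumFin {n} (λ i → sumFin (λ α → B α * δ α (lookup σ i))))
                           ≈ sites (λ _ → 1) σ
      exp-field-energy {n} σ = begin
        exp (β * sumFin vertexEnergy)                 ≈⟨ exp-cong (*-distribˡ-sumFin β vertexEnergy) ⟩
        exp (sumFin (λ i → β * vertexEnergy i))      ≈⟨ exp-sumFin (λ i → β * vertexEnergy i) ⟩
        prodFin (λ i → exp (β * vertexEnergy i))
          ≈⟨ prodFin-cong (λ i → exp-cong (*-congˡ (field-at (lookup σ i)))) ⟩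
        sites (λ _ → 1) σ ∎
        where
        vertexEnergy : Fin n → Carrier
        vertexEnergy i = sumFin (λ α → B α * δ α (lookup σ i))
        field-at : ∀ c → sumFin (λ α → B α * δ α c) ≈ fromℕ 1 * B c
        field-at c = trans (siftʳ c B) (sym (trans (*-congʳ (+-identityʳ 1#)) (*-identityˡ (B c))))

      boltzmann : ∀ (G : Graph) σ → exp (- (β * hamiltonian J B G σ))
                                       ≈ weight (λ _ → 1) (Graph.edges G) σ
      boltzmann (graph n m es) σ = begin
        exp (- (β * (- (J * sumVec (agree σ) es) + - fieldEnergy)))
          ≈⟨ exp-cong (negate-scaled-negatives β _ _) ⟩
        exp (β * (J * sumVec (agree σ) es) + β * fieldEnergy)
          ≈⟨ exp-+ _ _ ⟩
        exp (β * (J * sumVec (agree σ) es)) * exp (β * fieldEnergy)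
          ≈⟨ *-cong (exp-coupling-energy σ es) (exp-field-energy σ) ⟩
        weight (λ _ → 1) es σ ∎
        where
        fieldEnergy : Carrier
        fieldEnergy = sumFin {n} (λ i → sumFin (λ α → B α * δ α (lookup σ i)))

      -- Theorem 5.2: the case of unit vertex weights.
      partition-function : ∀ (G : Graph) → Z exp β J B G ≈ pow d (Graph.nV G) * U G x y
      partition-function G@(graph n m es) =
        trans (sumStates-cong (boltzmann G)) (Zω≈W (λ _ → 1) es)

theorem5p2 : ∀ {c ℓ : Level} (R : CommutativeRing c ℓ) →
    let open CommutativeRing R
        open Poly R
    in (exp : Carrier → Carrier) →
       (∀ {a b} → a ≈ b → exp a ≈ exp b) →
       (∀ a b → exp (a + b) ≈ exp a * exp b) →
       exp 0# ≈ 1# →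
       (q : ℕ) → 1 ≤ q →
       (β J : Carrier) (B : Fin q → Carrier) →
       (inv : Carrier) → inv * (exp (β * J) + - 1#) ≈ 1# →
       (G : Graph) →
       Z exp β J B G
         ≈ pow (exp (β * J) + - 1#) (Graph.nV G)
           * U G (λ k → inv * sumFin {q} (λ α → exp (β * (fromℕ k * B α))))
                 (exp (β * J))
theorem5p2 R exp exp-cong exp-+ exp-0 q _ β J B inv inv-inverse =
  PottsModel.partition-function
  where
  module PottsModel = Development.Exponential.Potts R exp exp-cong exp-+ exp-0 q β J B inv inv-inverse
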